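{- Let $m \geq 2$ and let $S$ be a nonempty finite set of positive integers that is sum-free modulo $m$ and has the property that whenever $s_{i_1}, s_{i_2}, s_{i_3}, s_{i_4} \in S$ satisfy $s_{i_1} + s_{i_2} \equiv s_{i_3} + s_{i_4} \pmod m$, then $s_{i_1} + s_{i_2} = s_{i_3} + s_{i_4}$. Let $A = \{um + s : u \geq 0,\ s \in S\}$; every $a \in A$ has a unique representation $a = u(a)m + s(a)$ with $u(a) \geq 0$ and $s(a) \in S$. For a positive integer $n$, let $\mathcal{A}(n)$ be the set of partitions of $n$ of the form $n = a_1 + \cdots + a_k$ with $a_i \in A$ and $u(a_1) > \cdots > u(a_k) \geq 0$, and let $p_{\mathcal{A}}(n) = |\mathcal{A}(n)|$. Let $B = \{um + s + s' : u \geq 1,\ s, s' \in S\}$ and $H = A \cup B$. Each $h \in H$ can be written uniquely as $h = v(h)m + t(h)$ with $v(h) \geq 0$ and $t(h) \in S \cup 2S$, where $2S = \{s + s' : s, s' \in S\}$. Let $\mathcal{H}(n)$ be the set of partitions $\pi' = (h_1,\ldots,h_d)$ of $n$, with parts listed in the order given by the following conditions, such that $h_i \in H$ for all $i$, $v(h_i) - v(h_{i+1}) \geq 3$ for $i = 1,\ldots,d-1$, and $v(h_i) - v(h_{i+1}) \geq 4$ whenever $h_{i+1} \in B$. For $h \in B$ let $r(h)$ be the number of ordered pairs $(s,s') \in S \times S$ with $s + s' = t(h)$, and for $h \in A$ let $r(h) = 1$. Then \[ p_{\mathcal{A}}(n) = \sum_{\substack{\pi' \in \mathcal{H}(n)\\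 \pi' = (h_1,\ldots,h_d)}} \prod_{i=1}^d r(h_i). \]
   Context: A set $S$ of integers is sum-free modulo $m$ if its elements are pairwise incongruent modulo $m$ and the congruence $s_{i_1} + s_{i_2} \equiv s_j \pmod m$ has no solution with $s_{i_1}, s_{i_2}, s_j \in S$. Elements of $S$ are not required to lie in $\{1,\ldots,m\}$. -}

module Defs where

open import Data.Nat using (ℕ; _+_; _*_; _≤_; _<_; _≟_)
open import Data.Product using (Σ; ∃; ∃-syntax; _×_; _,_; proj₁; proj₂)
open import Data.Sum using (_⊎_)
open import Data.List using (List; []; _∷_; length; filter; cartesianProduct; map)
open import Data.Nat.ListAction using (sum)
open import Data.Empty using (⊥)
open import Data.List.Membership.Propositional using (_∈_)
open import Data.List.Relation.Unary.All using (All)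
open import Data.List.Relation.Unary.Linked using (Linked)
open import Data.List.Relation.Unary.Unique.Propositional using (Unique)
open import Relation.Binary.PropositionalEquality using (_≡_)

Congr : ℕ → ℕ → ℕ → Set
Congr m a b = ∃[ k ] (a ≡ b + k * m ⊎ b ≡ a + k * m)

SumFreeMod : ℕ → List ℕ → Set
SumFreeMod m S =
  (∀ {s s'} → s ∈ S → s' ∈ S → Congr m s s' → s ≡ s')
  × (∀ {s₁ s₂ s₃} → s₁ ∈ S → s₂ ∈ S → s₃ ∈ S → Congr m (s₁ + s₂) s₃ → ⊥)

TwoSumCondition : ℕ → List ℕ → Set
TwoSumCondition m S = ∀ {s₁ s₂ s₃ s₄} → s₁ ∈ S → s₂ ∈ S → s₃ ∈ S → s₄ ∈ S →
  Congr m (s₁ + s₂) (s₃ + s₄) → s₁ + s₂ ≡ s₃ + s₄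

RepA : ℕ → List ℕ → ℕ → ℕ → ℕ → Set
RepA m S a u s = s ∈ S × a ≡ u * m + s

InA : ℕ → List ℕ → ℕ → Set
InA m S a = ∃[ u ] ∃[ s ] RepA m S a u s

InB : ℕ → List ℕ → ℕ → Set
InB m S h = ∃[ u ] ∃[ s ] ∃[ s' ] (1 ≤ u × s ∈ S × s' ∈ S × h ≡ u * m + s + s')

InH : ℕ → List ℕ → ℕ → Set
InH m S h = InA m S h ⊎ InB m S h

In2S : List ℕ → ℕ → Set
In2S S t = ∃[ s ] ∃[ s' ] (s ∈ S × s' ∈ S × t ≡ s + s')

RepH : ℕ → List ℕ → ℕ → ℕ → ℕ → Set
RepH m S h v t = (t ∈ S ⊎ In2S S t) × h ≡ v * m + t

StepA : ℕ → List ℕ → ℕ → ℕ → Set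
StepA m S a a' = ∀ {u s u' s'} → RepA m S a u s → RepA m S a' u' s' → u' < u

APart : ℕ → List ℕ → ℕ → List ℕ → Set
APart m S n π = All (InA m S) π × Linked (StepA m S) π × sum π ≡ n

StepH : ℕ → List ℕ → ℕ → ℕ → Set
StepH m S h h' = ∀ {v t v' t'} → RepH m S h v t → RepH m S h' v' t' →
  (v' + 3 ≤ v) × (InB m S h' → v' + 4 ≤ v)

HPart : ℕ → List ℕ → ℕ → List ℕ → Set
HPart m S n π = All (InH m S) π × Linked (StepH m S) π × sum π ≡ n

countPairs : List ℕ → ℕ → ℕ
countPairs S t = length (filter (λ p → proj₁ p + proj₂ p ≟ t) (cartesianProduct S S))

Weight : ℕ → List ℕ → ℕ → ℕ → Set
Weight m S h w =
  (InA m S h → w ≡ 1) × (InB m S h → ∀ {v t} → RepH m S h v t → w ≡ countPairs S t)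

data ProdWeight (m : ℕ) (S : List ℕ) : List ℕ → ℕ → Set where
  []  : ProdWeight m S [] 1
  _∷_ : ∀ {h r π w} → Weight m S h r → ProdWeight m S π w → ProdWeight m S (h ∷ π) (r * w)

-- L is a duplicate-free list of exactly the lists satisfying P (so |{π | P π}| = length L)
Enumerates : (List ℕ → Set) → List (List ℕ) → Set
Enumerates P L = Unique L × (∀ π → P π → π ∈ L) × (∀ π → π ∈ L → P π)

-- Call u(a₁) + (k − 1) the index of an A-partition a₁ + ⋯ + a_k. Take one of
-- index v with a₁ = u m + s. If its last part has u ≥ 1, removing a₁ and lowering every other
-- part by m leaves an A-partition of index ≤ v − 3; this matches the H-partitions starting
-- with v m + s ∈ A. If its last part is some s₀ ∈ S, remove that part too: what is left
-- matches the H-partitions starting with (v − 1) m + s₀ + s ∈ B, and each such part arises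
-- from r(h) pairs (s₀, s). Hence the number of A-partitions and the r-weighted number of
-- H-partitions of bounded index obey the same recursion in the bound; sum-freeness makes
-- the representations u m + s and v m + t unique, so the generators below enumerate each
-- partition exactly once.

module Submission where

open import Data.Bool using (if_then_else_)
open import Data.Empty using (⊥; ⊥-elim)
open import Data.List
  using (List; []; _∷_; _++_; _∷ʳ_; length; map; concatMap; filter; cartesianProduct; deduplicate)
open import Data.List.Membership.Propositional using (_∈_; find; lose)
open import Data.List.Membership.Propositional.Properties
  using (∈-map⁺; ∈-map⁻; ∈-++⁺ˡ; ∈-++⁺ʳ; ∈-++⁻; ∈-concatMap⁺; ∈-concatMap⁻;
         ∈-cartesianProduct⁺; ∈-cartesianProduct⁻; ∈-deduplicate⁺; ∈-deduplicate⁻)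
open import Data.List.Properties
  using (length-map; length-++; map-∘; map-cong; map-++; map-concatMap; concatMap-cong;
         map-injective; ∷-injective; ∷-injectiveˡ; ∷-injectiveʳ; ∷ʳ-injective;
         filter-accept; filter-reject)
import Data.List.Relation.Unary.All as All
open All using (All; []; _∷_)
import Data.List.Relation.Unary.All.Properties as Allₚ
open import Data.List.Relation.Unary.Any using (here; there)
import Data.List.Relation.Unary.Linked as Linked
open Linked using (Linked; []; [-]; _∷_)
import Data.List.Relation.Unary.Linked.Properties as Linkedₚ
open import Data.List.Relation.Unary.Unique.Propositional using (Unique; []; _∷_)
import Data.List.Relation.Unary.Unique.Propositional.Properties as Unique
open import Data.List.Relation.Unary.Unique.DecPropositional.Properties using (deduplicate-!)
open import Data.List.Relation.Binary.Disjoint.Propositional using (Disjoint)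
open import Data.Nat
  using (ℕ; zero; suc; _+_; _*_; _∸_; _≤_; _<_; _≟_; _≤?_; z≤n; s≤s; NonZero; >-nonZero)
open import Data.Nat.ListAction using (sum)
open import Data.Nat.ListAction.Properties using (sum-++)
open import Data.Nat.Properties
open import Data.Nat.Tactic.RingSolver using (solve-∀)
open import Data.Product using (∃-syntax; _×_; _,_; proj₁; proj₂; uncurry)
import Data.Product as Product
open import Data.Unit using (⊤; tt)
open import Data.Sum using (_⊎_; inj₁; inj₂; [_,_]′)
open import Function using (_∘_)
open import Relation.Nullary using (Dec; yes; no; does; ¬_)
open import Relation.Nullary.Decidable using (dec-true; dec-false)
open import Relation.Binary.PropositionalEquality

open import Algebra.Properties.CommutativeSemigroup +-commutativeSemigroup
  using () renaming (interchange to +-interchange)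

open import Defs

guard : {A P : Set} → Dec P → List A → List A
guard d xs = if does d then xs else []

module _ {A P : Set} where

  ∈-guard⁻ : {d : Dec P} {x : A} {xs : List A} → x ∈ guard d xs → P × x ∈ xs
  ∈-guard⁻ {d = yes p} x∈ = p , x∈

  ∈-guard⁺ : (d : Dec P) {x : A} {xs : List A} → P → x ∈ xs → x ∈ guard d xs
  ∈-guard⁺ (yes _) _ x∈ = x∈
  ∈-guard⁺ (no ¬p) p _ = ⊥-elim (¬p p)

  guard-unique : (d : Dec P) {xs : List A} → Unique xs → Unique (guard d xs)
  guard-unique (yes _) u = u
  guard-unique (no _) _ = []

  map-guard : {B : Set} (f : A → B) (d : Dec P) (xs : List A) → map f (guard d xs) ≡ guard d (map f xs)
  map-guard f (yes _) xs = refl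
  map-guard f (no _) xs = refl

split-sum : ∀ {h k n} → h + k ≡ n → h ≤ n × k ≡ n ∸ h
split-sum {h} {k} refl = m≤m+n h k , sym (m+n∸m≡n h k)

+-suc-suc : ∀ L x → L + suc (suc x) ≡ suc (suc (L + x))
+-suc-suc L x = trans (+-suc L (suc x)) (cong suc (+-suc L x))

4+[L+x]≤2+[L+u]⇒2+x≤u : ∀ L x u → 4 + (L + x) ≤ 2 + (L + u) → 2 + x ≤ u
4+[L+x]≤2+[L+u]⇒2+x≤u L x u le =
  +-cancelˡ-≤ L _ _ (subst (_≤ L + u) (sym (+-suc-suc L x)) (≤-pred (≤-pred le)))

2+x≤u⇒4+[L+x]≤2+[L+u] : ∀ L x u → 2 + x ≤ u → 4 + (L + x) ≤ 2 + (L + u)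
2+x≤u⇒4+[L+x]≤2+[L+u] L x u le = s≤s (s≤s (subst (_≤ L + u) (+-suc-suc L x) (+-monoʳ-≤ L le)))

length≤sum : ∀ {xs} → All (1 ≤_) xs → length xs ≤ sum xs
length≤sum [] = z≤n
length≤sum (1≤x ∷ 1≤xs) = +-mono-≤ 1≤x (length≤sum 1≤xs)

module _ {A : Set} where

  length-∷ʳ : ∀ (xs : List A) {x} → length (xs ∷ʳ x) ≡ suc (length xs)
  length-∷ʳ xs = trans (length-++ xs) (+-comm (length xs) 1)

  length≡sum-map-1 : (xs : List A) → length xs ≡ sum (map (λ _ → 1) xs)
  length≡sum-map-1 [] = refl
  length≡sum-map-1 (x ∷ xs) = cong suc (length≡sum-map-1 xs)

  sum-map-+ : (f g : A → ℕ) (xs : List A) →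
    sum (map (λ x → f x + g x) xs) ≡ sum (map f xs) + sum (map g xs)
  sum-map-+ f g [] = refl
  sum-map-+ f g (x ∷ xs) =
    trans (cong (f x + g x +_) (sum-map-+ f g xs)) (+-interchange (f x) (g x) _ _)

  sum-map-++ : (w : A → ℕ) (xs ys : List A) → sum (map w (xs ++ ys)) ≡ sum (map w xs) + sum (map w ys)
  sum-map-++ w xs ys = trans (cong sum (map-++ w xs ys)) (sum-++ (map w xs) (map w ys))

  sum-map-scale : {B : Set} (w : B → ℕ) (w′ : A → ℕ) (r : ℕ) (φ : A → B) →
    (∀ x → w (φ x) ≡ r * w′ x) → (xs : List A) → sum (map w (map φ xs)) ≡ r * sum (map w′ xs)
  sum-map-scale w w′ r φ eq [] = sym (*-zeroʳ r)
  sum-map-scale w w′ r φ eq (x ∷ xs) =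
    trans (cong₂ _+_ (eq x) (sum-map-scale w w′ r φ eq xs)) (sym (*-distribˡ-+ r (w′ x) _))

indicator : ℕ → (ℕ → ℕ) → ℕ → ℕ
indicator a f t = if does (a ≟ t) then f t else 0

module _ (f : ℕ → ℕ) where

  indicator-≡ : ∀ {a t} → a ≡ t → indicator a f t ≡ f t
  indicator-≡ {a} {t} a≡t = cong (if_then f t else 0) (dec-true (a ≟ t) a≡t)

  indicator-≢ : ∀ {a t} → a ≢ t → indicator a f t ≡ 0
  indicator-≢ {a} {t} a≢t = cong (if_then f t else 0) (dec-false (a ≟ t) a≢t)

  sum-map-indicator : ∀ {a ts} → Unique ts → a ∈ ts → sum (map (indicator a f) ts) ≡ f a
  sum-map-indicator {a} {t ∷ ts} (t∉ ∷ _) (here refl) =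
    trans (cong₂ _+_ (indicator-≡ refl) (absent t∉)) (+-identityʳ (f a))
    where
      absent : ∀ {ts} → All (a ≢_) ts → sum (map (indicator a f) ts) ≡ 0
      absent [] = refl
      absent (a≢t ∷ a∉) = cong₂ _+_ (indicator-≢ a≢t) (absent a∉)
  sum-map-indicator {a} {t ∷ ts} (t∉ ∷ uts) (there a∈) =
    cong₂ _+_ (indicator-≢ {a} (λ { refl → All.lookup t∉ a∈ refl })) (sum-map-indicator uts a∈)

module _ {X : Set} (g : X → ℕ) (f : ℕ → ℕ) where

  count-∷ : ∀ x xs t → length (filter (λ y → g y ≟ t) (x ∷ xs)) * f t
                        ≡ indicator (g x) f t + length (filter (λ y → g y ≟ t) xs) * f t
  count-∷ x xs t with g x ≟ t
  ... | yes e = trans (cong (λ l → length l * f t) (filter-accept (λ y → g y ≟ t) e))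
                      (cong (_+ _) (sym (indicator-≡ f e)))
  ... | no ¬e = trans (cong (λ l → length l * f t) (filter-reject (λ y → g y ≟ t) ¬e))
                      (cong (_+ _) (sym (indicator-≢ f ¬e)))

  sum-map-fibres : ∀ xs {ts} → Unique ts → (∀ {x} → x ∈ xs → g x ∈ ts) →
    sum (map (λ t → length (filter (λ x → g x ≟ t) xs) * f t) ts) ≡ sum (map (f ∘ g) xs)
  sum-map-fibres [] {ts} _ _ = zeros ts
    where
      zeros : ∀ ts → sum (map (λ _ → 0) ts) ≡ 0
      zeros [] = refl
      zeros (_ ∷ ts) = zeros ts
  sum-map-fibres (x ∷ xs) {ts} uts ⊆ts = begin
    sum (map (λ t → length (filter (λ y → g y ≟ t) (x ∷ xs)) * f t) ts)
      ≡⟨ cong sum (map-cong (count-∷ x xs) ts) ⟩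
    sum (map (λ t → indicator (g x) f t + length (filter (λ y → g y ≟ t) xs) * f t) ts)
      ≡⟨ sum-map-+ (indicator (g x) f) _ ts ⟩
    sum (map (indicator (g x) f) ts) + sum (map (λ t → length (filter (λ y → g y ≟ t) xs) * f t) ts)
      ≡⟨ cong₂ _+_ (sum-map-indicator f uts (⊆ts (here refl))) (sum-map-fibres xs uts (⊆ts ∘ there)) ⟩
    f (g x) + sum (map (f ∘ g) xs) ∎
    where open ≡-Reasoning

module _ {K X Y : Set} (size : K → ℕ) (φ : K → X → Y) (G : ℕ → List X) (n : ℕ) where

  extension : K → List Y
  extension k = guard (size k ≤? n) (map (φ k) (G (n ∸ size k)))

  extensions : List K → List Y
  extensions = concatMap extension

  ∈-extension⁻ : ∀ {k y} → y ∈ extension k → size k ≤ n × ∃[ x ] (x ∈ G (n ∸ size k) × y ≡ φ k x)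
  ∈-extension⁻ {k} y∈ with ∈-guard⁻ {d = size k ≤? n} y∈
  ... | fits , y∈map = fits , ∈-map⁻ _ y∈map

  ∈-extensions⁻ : ∀ ks {y} → y ∈ extensions ks →
    ∃[ k ] ∃[ x ] (k ∈ ks × size k ≤ n × x ∈ G (n ∸ size k) × y ≡ φ k x)
  ∈-extensions⁻ ks y∈ with find (∈-concatMap⁻ extension {xs = ks} y∈)
  ... | k , k∈ , y∈k with ∈-extension⁻ y∈k
  ...   | fits , x , x∈ , refl = k , x , k∈ , fits , x∈ , refl

  ∈-extensions⁺ : ∀ ks {k x} → k ∈ ks → size k ≤ n → x ∈ G (n ∸ size k) → φ k x ∈ extensions ks
  ∈-extensions⁺ ks {k} k∈ fits x∈ =
    ∈-concatMap⁺ extension (lose k∈ (∈-guard⁺ (size k ≤? n) fits (∈-map⁺ (φ k) x∈)))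

  extensions-unique : ∀ {ks} → Unique ks → (∀ n′ → Unique (G n′)) →
    (∀ {k k′ x x′} → k ∈ ks → k′ ∈ ks → φ k x ≡ φ k′ x′ → k ≡ k′ × x ≡ x′) →
    Unique (extensions ks)
  extensions-unique {[]} [] _ _ = []
  extensions-unique {k ∷ ks} (k∉ ∷ uks) uG inj =
    Unique.++⁺ (guard-unique (size k ≤? n)
                  (Unique.map⁺ (λ e → proj₂ (inj (here refl) (here refl) e)) (uG _)))
               (extensions-unique uks uG (λ k∈ k′∈ → inj (there k∈) (there k′∈)))
               disjoint
    where
      disjoint : Disjoint (extension k) (extensions ks)
      disjoint (y∈k , y∈ks) with ∈-extension⁻ y∈k | ∈-extensions⁻ ks y∈ks
      ... | _ , x , _ , refl | k′ , x′ , k′∈ , _ , _ , e with inj (here refl) (there k′∈) e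
      ...   | refl , _ = All.lookup k∉ k′∈ refl

  sum-map-extensions : ∀ (w : Y → ℕ) (w′ : X → ℕ) (r : K → ℕ) →
    (∀ k x → w (φ k x) ≡ r k * w′ x) → ∀ ks →
    sum (map w (extensions ks))
      ≡ sum (map (λ k → r k * (if does (size k ≤? n) then sum (map w′ (G (n ∸ size k))) else 0)) ks)
  sum-map-extensions w w′ r eq [] = refl
  sum-map-extensions w w′ r eq (k ∷ ks) = begin
    sum (map w (extension k ++ extensions ks))
      ≡⟨ sum-map-++ w (extension k) _ ⟩
    sum (map w (extension k)) + sum (map w (extensions ks))
      ≡⟨ cong₂ _+_ (per-key (size k ≤? n)) (sum-map-extensions w w′ r eq ks) ⟩
    _ ∎
    where
      open ≡-Reasoning
      per-key : (d : Dec (size k ≤ n)) → sum (map w (guard d (map (φ k) (G (n ∸ size k)))))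
                                          ≡ r k * (if does d then sum (map w′ (G (n ∸ size k))) else 0)
      per-key (yes _) = sum-map-scale w w′ (r k) (φ k) (eq k) (G (n ∸ size k))
      per-key (no _) = sym (*-zeroʳ (r k))

module _ {K X Y W Z : Set} (size : K → ℕ) (n : ℕ) where

  map-extensions : (f : Y → Z) (φ : K → X → Y) (ψ : K → W → Z) (g : X → W) (G : ℕ → List X) →
    (∀ k x → f (φ k x) ≡ ψ k (g x)) → ∀ ks →
    map f (extensions size φ G n ks) ≡ extensions size ψ (map g ∘ G) n ks
  map-extensions f φ ψ g G eq ks = trans (map-concatMap f _ ks) (concatMap-cong per-key ks)
    where
      per-key : ∀ k → map f (extension size φ G n k) ≡ extension size ψ (map g ∘ G) n k
      per-key k = trans (map-guard f (size k ≤? n) _) (cong (guard (size k ≤? n)) (begin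
        map f (map (φ k) (G (n ∸ size k)))     ≡⟨ map-∘ _ ⟨
        map (f ∘ φ k) (G (n ∸ size k))         ≡⟨ map-cong (eq k) _ ⟩
        map (ψ k ∘ g) (G (n ∸ size k))         ≡⟨ map-∘ _ ⟩
        map (ψ k) (map g (G (n ∸ size k)))     ∎))
        where open ≡-Reasoning

module _ {R : ℕ → ℕ → Set} where

  Linked-∷ʳ⁺ : ∀ {xs y} → Linked R xs → All (λ x → R x y) xs → Linked R (xs ∷ʳ y)
  Linked-∷ʳ⁺ [] [] = [-]
  Linked-∷ʳ⁺ [-] (r ∷ []) = r ∷ [-]
  Linked-∷ʳ⁺ (r ∷ l) (_ ∷ rs) = r ∷ Linked-∷ʳ⁺ l rs

  Linked-++⁻ˡ : ∀ xs {ys} → Linked R (xs ++ ys) → Linked R xs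
  Linked-++⁻ˡ [] _ = []
  Linked-++⁻ˡ (x ∷ []) _ = [-]
  Linked-++⁻ˡ (x ∷ x′ ∷ xs) (r ∷ l) = r ∷ Linked-++⁻ˡ (x′ ∷ xs) l

module Partitions (m : ℕ) .{{_ : NonZero m}} (S : List ℕ) (S-unique : Unique S)
                  (sumFree : SumFreeMod m S) (twoSum : TwoSumCondition m S) where

  -- Unique representations

  Congr-sym : ∀ {x y} → Congr m x y → Congr m y x
  Congr-sym (k , inj₁ e) = k , inj₂ e
  Congr-sym (k , inj₂ e) = k , inj₁ e

  residues-congruent-≤ : ∀ {u u′ x y} → u ≤ u′ → u * m + x ≡ u′ * m + y → Congr m x y
  residues-congruent-≤ {u} {x = x} {y} u≤u′ eq with d , refl ← m≤n⇒∃[o]m+o≡n u≤u′ =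
    d , inj₁ (+-cancelˡ-≡ (u * m) x _ (trans eq (shuffle m u d y)))
    where shuffle : ∀ m u d y → (u + d) * m + y ≡ u * m + (y + d * m)
          shuffle = solve-∀

  residues-congruent : ∀ u u′ {x y} → u * m + x ≡ u′ * m + y → Congr m x y
  residues-congruent u u′ eq with ≤-total u u′
  ... | inj₁ u≤u′ = residues-congruent-≤ u≤u′ eq
  ... | inj₂ u′≤u = Congr-sym (residues-congruent-≤ u′≤u (sym eq))

  S-positive : ∀ {s} → s ∈ S → 1 ≤ s
  S-positive {zero} s∈ = ⊥-elim (proj₂ sumFree s∈ s∈ s∈ (0 , inj₁ refl))
  S-positive {suc s} _ = s≤s z≤n

  same-quotient : ∀ {u u′ x y} → u * m + x ≡ u′ * m + y → x ≡ y → u ≡ u′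
  same-quotient {u} {u′} {x} eq refl = *-cancelʳ-≡ u u′ m (+-cancelʳ-≡ x _ _ eq)

  same-residue : ∀ u u′ {s s′} → s ∈ S → s′ ∈ S → u * m + s ≡ u′ * m + s′ → s ≡ s′
  same-residue u u′ s∈ s′∈ eq = proj₁ sumFree s∈ s′∈ (residues-congruent u u′ eq)

  RepA-unique : ∀ {a u s u′ s′} → RepA m S a u s → RepA m S a u′ s′ → u ≡ u′ × s ≡ s′
  RepA-unique {u = u} {u′ = u′} (s∈ , refl) (s′∈ , eq) =
    let s≡s′ = same-residue u u′ s∈ s′∈ eq in same-quotient eq s≡s′ , s≡s′

  Congr-S∪2S⇒≡ : ∀ {t t′} → (t ∈ S ⊎ In2S S t) → (t′ ∈ S ⊎ In2S S t′) → Congr m t t′ → t ≡ t′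
  Congr-S∪2S⇒≡ (inj₁ t∈) (inj₁ t′∈) c = proj₁ sumFree t∈ t′∈ c
  Congr-S∪2S⇒≡ (inj₁ t∈) (inj₂ (_ , _ , s₀∈ , s₁∈ , refl)) c =
    ⊥-elim (proj₂ sumFree s₀∈ s₁∈ t∈ (Congr-sym c))
  Congr-S∪2S⇒≡ (inj₂ (_ , _ , s₀∈ , s₁∈ , refl)) (inj₁ t′∈) c =
    ⊥-elim (proj₂ sumFree s₀∈ s₁∈ t′∈ c)
  Congr-S∪2S⇒≡ (inj₂ (_ , _ , s₀∈ , s₁∈ , refl)) (inj₂ (_ , _ , s₂∈ , s₃∈ , refl)) c =
    twoSum s₀∈ s₁∈ s₂∈ s₃∈ c

  RepH-unique : ∀ {h v t v′ t′} → RepH m S h v t → RepH m S h v′ t′ → v ≡ v′ × t ≡ t′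
  RepH-unique {v = v} {v′ = v′} (t∈ , refl) (t′∈ , eq) =
    let t≡t′ = Congr-S∪2S⇒≡ t∈ t′∈ (residues-congruent v v′ eq) in same-quotient eq t≡t′ , t≡t′

  InA⇒¬InB : ∀ {h} → InA m S h → ¬ InB m S h
  InA⇒¬InB (u , s , s∈ , refl) (u′ , s₀ , s₁ , _ , s₀∈ , s₁∈ , eq) =
    proj₂ sumFree s₀∈ s₁∈ s∈ (residues-congruent u′ u (trans (sym (+-assoc (u′ * m) s₀ s₁)) (sym eq)))

  RepA⇒RepH : ∀ {a u s} → RepA m S a u s → RepH m S a u s
  RepA⇒RepH (s∈ , eq) = inj₁ s∈ , eq

  -- Raising A-partitions by m

  shift : List ℕ → List ℕ
  shift = map (m +_)

  RepA-shift : ∀ {a u s} → RepA m S a u s → RepA m S (m + a) (suc u) s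
  RepA-shift {u = u} {s} (s∈ , refl) = s∈ , sym (+-assoc m (u * m) s)

  RepA-S : ∀ {s} → s ∈ S → RepA m S s 0 s
  RepA-S s∈ = s∈ , refl

  StepA-intro : ∀ {a b u s u′ s′} → RepA m S a u s → RepA m S b u′ s′ → u′ < u → StepA m S a b
  StepA-intro ra rb u′<u ra′ rb′ = subst₂ _<_ (proj₁ (RepA-unique rb rb′)) (proj₁ (RepA-unique ra ra′)) u′<u

  StepA-unshift : ∀ {a b} → StepA m S (m + a) (m + b) → StepA m S a b
  StepA-unshift st {u} {s} {u′} {s′} ra rb =
    ≤-pred (st {suc u} {s} {suc u′} {s′} (RepA-shift {u = u} ra) (RepA-shift {u = u′} rb))

  shift-All : ∀ {π} → All (InA m S) π → All (InA m S) (shift π)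
  shift-All = Allₚ.map⁺ ∘ All.map (λ { (u , s , ra) → suc u , s , RepA-shift {u = u} ra })

  shift-Linked : ∀ {π} → All (InA m S) π → Linked (StepA m S) π → Linked (StepA m S) (shift π)
  shift-Linked _ [] = []
  shift-Linked _ [-] = [-]
  shift-Linked ((u , s , ra) ∷ ib@(u′ , s′ , rb) ∷ al) (st ∷ l) =
    StepA-intro (RepA-shift {u = u} ra) (RepA-shift {u = u′} rb) (s≤s (st {u = u} {u' = u′} ra rb))
      ∷ shift-Linked (ib ∷ al) l

  unshift-Linked : ∀ {π} → Linked (StepA m S) (shift π) → Linked (StepA m S) π
  unshift-Linked = Linked.map StepA-unshift ∘ Linkedₚ.map⁻

  sum-shift : ∀ π → sum (shift π) ≡ length π * m + sum π
  sum-shift [] = refl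
  sum-shift (a ∷ π) = trans (cong (m + a +_) (sum-shift π)) (shuffle m a (length π * m) (sum π))
    where shuffle : ∀ m a x y → m + a + (x + y) ≡ m + x + (a + y)
          shuffle = solve-∀

  High : ℕ → Set
  High a = ∃[ u ] ∃[ s ] RepA m S a (suc u) s

  shift-High : ∀ {π} → All (InA m S) π → All High (shift π)
  shift-High = Allₚ.map⁺ ∘ All.map (λ { (u , s , ra) → u , s , RepA-shift {u = u} ra })

  S-¬High : ∀ {s} → s ∈ S → ¬ High s
  S-¬High s∈ (u , _ , ra) with () ← proj₁ (RepA-unique {u = 0} {u′ = suc u} (RepA-S s∈) ra)

  High-if-followed : ∀ {a b} → InA m S a → InA m S b → StepA m S a b → High a
  High-if-followed (zero , s , ra) (u′ , s′ , rb) st with () ← st {zero} {s} {u′} {s′} ra rb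
  High-if-followed (suc u , s , ra) _ _ = u , s , ra

  High-unshift : ∀ {a} → High a → ∃[ a′ ] (a ≡ m + a′ × InA m S a′)
  High-unshift (u , s , s∈ , refl) = u * m + s , +-assoc m (u * m) s , u , s , s∈ , refl

  data ShiftView (π₀ : List ℕ) : Set where
    shifted   : ∀ π → All (InA m S) π → π₀ ≡ shift π → ShiftView π₀
    shifted∷ʳ : ∀ π {s} → All (InA m S) π → s ∈ S → π₀ ≡ shift π ∷ʳ s → ShiftView π₀

  shiftView : ∀ {π₀} → All (InA m S) π₀ → Linked (StepA m S) π₀ → ShiftView π₀
  shiftView [] _ = shifted [] [] refl
  shiftView ((zero , s , s∈ , refl) ∷ []) _ = shifted∷ʳ [] [] s∈ refl
  shiftView ((suc u , s , ra) ∷ []) _ with a′ , refl , ia′ ← High-unshift (u , s , ra) =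
    shifted (a′ ∷ []) (ia′ ∷ []) refl
  shiftView (ia ∷ ib ∷ al) (st ∷ l) with a′ , refl , ia′ ← High-unshift (High-if-followed ia ib st)
                                     with shiftView (ib ∷ al) l
  ... | shifted π al′ eq = shifted (a′ ∷ π) (ia′ ∷ al′) (cong (m + a′ ∷_) eq)
  ... | shifted∷ʳ π al′ s∈ eq = shifted∷ʳ (a′ ∷ π) (ia′ ∷ al′) s∈ (cong (m + a′ ∷_) eq)

  -- The generator of A-partitions

  pairs : List (ℕ × ℕ)
  pairs = cartesianProduct S S

  -- The A-partitions matching v m + s ∷ π and v m + s₀ + s₁ ∷ π. Their first part gets
  -- u = v − length π, so that the index is v (resp. v + 1); the truncated subtraction is
  -- exact for the π that occur, which have length π ≤ v.
  extendA : ℕ → ℕ → List ℕ → List ℕ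
  extendA v s π = (v ∸ length π) * m + s ∷ shift π

  extendB : ℕ → ℕ × ℕ → List ℕ → List ℕ
  extendB v (s₀ , s₁) π = (v ∸ length π) * m + s₁ ∷ (shift π ∷ʳ s₀)

  extendA-≡ : ∀ u s π → extendA (length π + u) s π ≡ u * m + s ∷ shift π
  extendA-≡ u s π = cong (λ d → d * m + s ∷ shift π) (m+n∸m≡n (length π) u)

  extendB-≡ : ∀ u s₀ s₁ π → extendB (suc (length π + u)) (s₀ , s₁) π ≡ suc u * m + s₁ ∷ (shift π ∷ʳ s₀)
  extendB-≡ u s₀ s₁ π =
    cong (λ d → d * m + s₁ ∷ (shift π ∷ʳ s₀))
         (trans (+-∸-assoc 1 (m≤m+n (length π) u)) (cong suc (m+n∸m≡n (length π) u)))

  tightA₁ : ℕ → (ℕ → List (List ℕ)) → ℕ → List (List ℕ)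
  tightA₁ v G n = extensions (v * m +_) (extendA v) G n S

  tightA₂ : ℕ → (ℕ → List (List ℕ)) → ℕ → List (List ℕ)
  tightA₂ (suc (suc v)) G n = extensions (λ p → suc v * m + uncurry _+_ p) (extendB (suc v)) G n pairs
  tightA₂ _ _ _ = []

  -- boundedA j n lists the A-partitions of n of index at most j − 4, and tightA j n those of
  -- index exactly j − 3.
  boundedA : ℕ → ℕ → List (List ℕ)
  tightA : ℕ → ℕ → List (List ℕ)

  boundedA zero n = guard (n ≟ 0) ([] ∷ [])
  boundedA (suc j) n = boundedA j n ++ tightA j n

  tightA (suc (suc (suc v))) n = tightA₁ v (boundedA (suc v)) n ++ tightA₂ v (boundedA v) n
  tightA _ _ = []

  BoundedA : ℕ → List ℕ → Set
  BoundedA j [] = ⊤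
  BoundedA j (a ∷ π) = ∀ u {s} → RepA m S a u s → 4 + (length π + u) ≤ j

  BelowA : ℕ → ℕ → List ℕ → Set
  BelowA j n π = APart m S n π × BoundedA j π

  AtA : ℕ → ℕ → List ℕ → Set
  AtA j n π = BelowA (suc j) n π × ¬ BoundedA j π

  BoundedA-intro : ∀ {j a π u s} → RepA m S a u s → 4 + (length π + u) ≤ j → BoundedA j (a ∷ π)
  BoundedA-intro {j} {π = π} {u} ra le u′ ra′ =
    subst (λ u → 4 + (length π + u) ≤ j) (proj₁ (RepA-unique {u = u} {u′ = u′} ra ra′)) le

  BoundedA-suc : ∀ {j} π → BoundedA j π → BoundedA (suc j) π
  BoundedA-suc [] _ = tt
  BoundedA-suc (a ∷ π) b u ra = m≤n⇒m≤1+n (b u ra)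

  BoundedA-exact : ∀ {j a π u s} → RepA m S a u s → 3 + (length π + u) ≡ j →
    BoundedA (suc j) (a ∷ π) × ¬ BoundedA j (a ∷ π)
  BoundedA-exact {π = π} {u} ra refl = BoundedA-intro {π = π} {u} ra ≤-refl , λ b → <-irrefl refl (b u ra)

  length-boundedA : ∀ {v π} → All (InA m S) π → BoundedA (2 + v) π → length π ≤ v
  length-boundedA [] _ = z≤n
  length-boundedA {π = a ∷ π} ((u , s , ra) ∷ _) b =
    ≤-pred (m≤n⇒m≤1+n (≤-pred (≤-pred (≤-trans (+-monoʳ-≤ 4 (m≤m+n (length π) u)) (b u ra)))))

  StepA-into-shift : ∀ {a u s x r} → RepA m S a u s → InA m S x →
    BoundedA (suc (length (x ∷ r) + u)) (x ∷ r) → StepA m S a (m + x)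
  StepA-into-shift {u = u} {r = r} ra (ux , sx , rx) b =
    StepA-intro ra (RepA-shift {u = ux} rx) (4+[L+x]≤2+[L+u]⇒2+x≤u (length r) ux u (b ux rx))

  StepA-into-S : ∀ {a s₀} → s₀ ∈ S → High a → StepA m S a s₀
  StepA-into-S s₀∈ (u , s , ra) = StepA-intro {u = suc u} {u′ = 0} ra (RepA-S s₀∈) (s≤s z≤n)

  cons-shift-Linked : ∀ {a u s π} → RepA m S a u s → All (InA m S) π → Linked (StepA m S) π →
    BoundedA (suc (length π + u)) π → Linked (StepA m S) (a ∷ shift π)
  cons-shift-Linked ra [] _ _ = [-]
  cons-shift-Linked {u = u} {π = _ ∷ r} ra (ix ∷ al) l b =
    StepA-into-shift {u = u} {r = r} ra ix b ∷ shift-Linked (ix ∷ al) l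

  cons-shift∷ʳ-Linked : ∀ {a u s s₀ π} → RepA m S a (suc u) s → s₀ ∈ S → All (InA m S) π →
    Linked (StepA m S) π → BoundedA (suc (length π + suc u)) π → Linked (StepA m S) (a ∷ (shift π ∷ʳ s₀))
  cons-shift∷ʳ-Linked {u = u} ra s₀∈ [] _ _ = StepA-into-S s₀∈ (u , _ , ra) ∷ [-]
  cons-shift∷ʳ-Linked {u = u} {π = _ ∷ r} ra s₀∈ (ix ∷ al) l b =
    StepA-into-shift {u = suc u} {r = r} ra ix b
      ∷ Linked-∷ʳ⁺ (shift-Linked (ix ∷ al) l) (All.map (StepA-into-S s₀∈) (shift-High (ix ∷ al)))

  sum-cons-shift : ∀ u s π → sum (u * m + s ∷ shift π) ≡ (length π + u) * m + s + sum π
  sum-cons-shift u s π = trans (cong (u * m + s +_) (sum-shift π)) (shuffle m u s (length π) (sum π))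
    where shuffle : ∀ m u s L k → u * m + s + (L * m + k) ≡ (L + u) * m + s + k
          shuffle = solve-∀

  sum-cons-shift∷ʳ : ∀ u s₀ s₁ π →
    sum (suc u * m + s₁ ∷ (shift π ∷ʳ s₀)) ≡ suc (length π + u) * m + (s₀ + s₁) + sum π
  sum-cons-shift∷ʳ u s₀ s₁ π = begin
    suc u * m + s₁ + sum (shift π ++ s₀ ∷ [])
      ≡⟨ cong (suc u * m + s₁ +_) (trans (sum-++ (shift π) (s₀ ∷ [])) (cong (_+ (s₀ + 0)) (sum-shift π))) ⟩
    suc u * m + s₁ + (length π * m + sum π + (s₀ + 0))
      ≡⟨ shuffle m u s₀ s₁ (length π) (sum π) ⟩
    suc (length π + u) * m + (s₀ + s₁) + sum π ∎
    where open ≡-Reasoning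
          shuffle : ∀ m u s₀ s₁ L k →
            suc u * m + s₁ + (L * m + k + (s₀ + 0)) ≡ suc (L + u) * m + (s₀ + s₁) + k
          shuffle = solve-∀

  cons-shift-AtA : ∀ {u s k π} → s ∈ S → BelowA (suc (length π + u)) k π →
    AtA (3 + (length π + u)) ((length π + u) * m + s + k) (u * m + s ∷ shift π)
  cons-shift-AtA {u} {s} {k} {π} s∈ ((al , l , refl) , b) =
    let bounded , ¬bounded = BoundedA-exact {π = shift π} {u} ra (cong (λ L → 3 + (L + u)) (length-map (m +_) π))
    in ((((u , s , ra) ∷ shift-All al) , cons-shift-Linked ra al l b , sum-cons-shift u s π) , bounded) , ¬bounded
    where ra : RepA m S (u * m + s) u s
          ra = s∈ , refl

  cons-shift∷ʳ-AtA : ∀ {u s₀ s₁ k π} → s₀ ∈ S → s₁ ∈ S → BelowA (2 + (length π + u)) k π →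
    AtA (5 + (length π + u)) (suc (length π + u) * m + (s₀ + s₁) + k) (suc u * m + s₁ ∷ (shift π ∷ʳ s₀))
  cons-shift∷ʳ-AtA {u} {s₀} {s₁} {k} {π} s₀∈ s₁∈ ((al , l , refl) , b) =
    let bounded , ¬bounded = BoundedA-exact {π = shift π ∷ʳ s₀} {suc u} ra index
        al′ = Allₚ.∷ʳ⁺ (shift-All al) (0 , s₀ , RepA-S s₀∈)
    in (((suc u , s₁ , ra) ∷ al′ , cons-shift∷ʳ-Linked ra s₀∈ al l b′ , sum-cons-shift∷ʳ u s₀ s₁ π) , bounded)
       , ¬bounded
    where
      ra : RepA m S (suc u * m + s₁) (suc u) s₁
      ra = s₁∈ , refl
      b′ : BoundedA (suc (length π + suc u)) π
      b′ = subst (λ j → BoundedA j π) (cong suc (sym (+-suc (length π) u))) b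
      index : 3 + (length (shift π ∷ʳ s₀) + suc u) ≡ 5 + (length π + u)
      index = trans (cong (λ L → 3 + (L + suc u)) (trans (length-∷ʳ (shift π)) (cong suc (length-map (m +_) π))))
                    (cong (4 +_) (+-suc (length π) u))

  extendA-sound : ∀ {v s n π} → s ∈ S → v * m + s ≤ n → BelowA (suc v) (n ∸ (v * m + s)) π →
    AtA (3 + v) n (extendA v s π)
  extendA-sound {s = s} {n} {π} s∈ fits below@((al , _) , b)
    with d , refl ← m≤n⇒∃[o]m+o≡n (length-boundedA al (BoundedA-suc π b)) =
    subst₂ (AtA _) (m+[n∸m]≡n fits) (sym (extendA-≡ d s π)) (cons-shift-AtA s∈ below)

  extendB-sound : ∀ {v s₀ s₁ n π} → s₀ ∈ S → s₁ ∈ S → suc v * m + (s₀ + s₁) ≤ n →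
    BelowA (2 + v) (n ∸ (suc v * m + (s₀ + s₁))) π → AtA (5 + v) n (extendB (suc v) (s₀ , s₁) π)
  extendB-sound {s₀ = s₀} {s₁} {n} {π} s₀∈ s₁∈ fits below@((al , _) , b)
    with d , refl ← m≤n⇒∃[o]m+o≡n (length-boundedA al b) =
    subst₂ (AtA _) (m+[n∸m]≡n fits) (sym (extendB-≡ d s₀ s₁ π)) (cons-shift∷ʳ-AtA s₀∈ s₁∈ below)

  tightA₁-sound : ∀ v {G} → (∀ {k π} → π ∈ G k → BelowA (suc v) k π) →
    ∀ {n π} → π ∈ tightA₁ v G n → AtA (3 + v) n π
  tightA₁-sound v {G} sound {n} π∈
    with s , _ , s∈ , fits , π′∈ , refl ← ∈-extensions⁻ (v * m +_) (extendA v) G n S π∈ =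
    extendA-sound s∈ fits (sound π′∈)

  tightA₂-sound : ∀ v {G} → (∀ {k π} → π ∈ G k → BelowA v k π) →
    ∀ {n π} → π ∈ tightA₂ v G n → AtA (3 + v) n π
  tightA₂-sound (suc (suc v)) {G} sound {n} π∈
    with (s₀ , s₁) , _ , p∈ , fits , π′∈ , refl
           ← ∈-extensions⁻ (λ p → suc v * m + uncurry _+_ p) (extendB (suc v)) G n pairs π∈ =
    let s₀∈ , s₁∈ = ∈-cartesianProduct⁻ S S p∈ in extendB-sound s₀∈ s₁∈ fits (sound π′∈)

  boundedA-sound : ∀ j {n π} → π ∈ boundedA j n → BelowA j n π
  tightA-sound : ∀ j {n π} → π ∈ tightA j n → AtA j n π

  boundedA-sound zero {zero} (here refl) = ([] , [] , refl) , tt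
  boundedA-sound (suc j) {n} π∈ =
    [ (λ π∈b → let part , b = boundedA-sound j π∈b in part , BoundedA-suc _ b)
    , (λ π∈t → proj₁ (tightA-sound j π∈t)) ]′
    (∈-++⁻ (boundedA j n) π∈)

  tightA-sound (suc (suc (suc v))) {n} π∈ =
    [ tightA₁-sound v (boundedA-sound (suc v)) , tightA₂-sound v (boundedA-sound v) ]′
    (∈-++⁻ (tightA₁ v (boundedA (suc v)) n) π∈)

  BoundedA-under : ∀ {a u s π} → RepA m S a u s → Linked (StepA m S) (a ∷ shift π) →
    BoundedA (suc (length π + u)) π
  BoundedA-under {π = []} _ _ = tt
  BoundedA-under {u = u} {π = x ∷ r} ra (st ∷ _) ux rx =
    2+x≤u⇒4+[L+x]≤2+[L+u] (length r) ux u (st {u = u} {u' = suc ux} ra (RepA-shift {u = ux} rx))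

  cons-shift-complete : ∀ {G u s n π} → (∀ {k π′} → BelowA (suc (length π + u)) k π′ → π′ ∈ G k) →
    s ∈ S → All (InA m S) π → APart m S n (u * m + s ∷ shift π) →
    u * m + s ∷ shift π ∈ tightA₁ (length π + u) G n
  cons-shift-complete {G} {u} {s} {n} {π} complete s∈ al (_ , lin , sm)
    with fits , rest ← split-sum (trans (sym (sum-cons-shift u s π)) sm) =
    subst (_∈ tightA₁ (length π + u) G n) (extendA-≡ u s π)
      (∈-extensions⁺ ((length π + u) * m +_) (extendA (length π + u)) G n S s∈ fits
        (complete ((al , unshift-Linked (Linked.tail lin) , rest) , BoundedA-under (s∈ , refl) lin)))

  cons-shift∷ʳ-complete : ∀ {G u s s₀ n π} → (∀ {k π′} → BelowA (2 + (length π + u)) k π′ → π′ ∈ G k) →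
    s ∈ S → s₀ ∈ S → All (InA m S) π → APart m S n (suc u * m + s ∷ (shift π ∷ʳ s₀)) →
    suc u * m + s ∷ (shift π ∷ʳ s₀) ∈ tightA₂ (2 + (length π + u)) G n
  cons-shift∷ʳ-complete {G} {u} {s} {s₀} {n} {π} complete s∈ s₀∈ al (_ , lin , sm)
    with fits , rest ← split-sum (trans (sym (sum-cons-shift∷ʳ u s₀ s π)) sm) =
    subst (_∈ tightA₂ (2 + (length π + u)) G n) (extendB-≡ u s₀ s π)
      (∈-extensions⁺ (λ p → suc (length π + u) * m + uncurry _+_ p) (extendB (suc (length π + u))) G n pairs
        (∈-cartesianProduct⁺ s₀∈ s∈) fits (complete ((al , unshift-Linked (Linked.tail lin₀) , rest) , bound)))
    where
      lin₀ : Linked (StepA m S) (suc u * m + s ∷ shift π)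
      lin₀ = Linked-++⁻ˡ (suc u * m + s ∷ shift π) lin
      bound : BoundedA (2 + (length π + u)) π
      bound = subst (λ j → BoundedA j π) (cong suc (+-suc (length π) u)) (BoundedA-under (s∈ , refl) lin₀)

  ExactA : ℕ → List ℕ → Set
  ExactA j [] = ⊥
  ExactA j (a ∷ π) = ∃[ u ] ∃[ s ] (RepA m S a u s × 3 + (length π + u) ≡ j)

  BoundedA-split : ∀ {j π} → All (InA m S) π → BoundedA (suc j) π → BoundedA j π ⊎ ExactA j π
  BoundedA-split [] _ = inj₁ tt
  BoundedA-split {j} {a ∷ π} ((u , s , ra) ∷ _) b with 4 + (length π + u) ≤? j
  ... | yes le = inj₁ (BoundedA-intro {π = π} {u} ra le)
  ... | no ¬le = inj₂ (u , s , ra , ≤-antisym (≤-pred (b u ra)) (≤-pred (≰⇒> ¬le)))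

  High-before-∷ʳ : ∀ {a xs s₀} → All (InA m S) (a ∷ (xs ∷ʳ s₀)) → Linked (StepA m S) (a ∷ (xs ∷ʳ s₀)) →
    High a
  High-before-∷ʳ {xs = []} (ia ∷ ib ∷ []) (st ∷ _) = High-if-followed ia ib st
  High-before-∷ʳ {xs = x ∷ xs} (ia ∷ ib ∷ _) (st ∷ _) = High-if-followed ia ib st

  index-shift : ∀ π {u v} → 3 + (length (shift π) + u) ≡ 3 + v → length π + u ≡ v
  index-shift π {u} e =
    trans (cong (_+ u) (sym (length-map (m +_) π))) (suc-injective (suc-injective (suc-injective e)))

  index-shift∷ʳ : ∀ π {s₀ u v} → 3 + (length (shift π ∷ʳ s₀) + suc u) ≡ 3 + v → 2 + (length π + u) ≡ v
  index-shift∷ʳ π {s₀} {u} {v} e = begin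
    2 + (length π + u)                  ≡⟨ cong suc (+-suc (length π) u) ⟨
    suc (length π + suc u)              ≡⟨ cong (λ L → suc L + suc u) (length-map (m +_) π) ⟨
    suc (length (shift π)) + suc u      ≡⟨ cong (_+ suc u) (length-∷ʳ (shift π)) ⟨
    length (shift π ∷ʳ s₀) + suc u      ≡⟨ suc-injective (suc-injective (suc-injective e)) ⟩
    v ∎
    where open ≡-Reasoning

  tightA-complete-at : ∀ v → (∀ {k π} → BelowA (suc v) k π → π ∈ boundedA (suc v) k) →
    (∀ {k π} → BelowA v k π → π ∈ boundedA v k) →
    ∀ {n π} → APart m S n π → ExactA (3 + v) π → π ∈ tightA (3 + v) n
  tightA-complete-at v complete₁ complete₀ {n} {a ∷ π₀} part@(ia ∷ al , lin , _) (u , s , (s∈ , refl) , e)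
    with shiftView al (Linked.tail lin)
  ... | shifted π al′ refl with refl ← index-shift π e =
    ∈-++⁺ˡ (cons-shift-complete complete₁ s∈ al′ part)
  ... | shifted∷ʳ π al′ s₀∈ refl
    with u′ , _ , ra′ ← High-before-∷ʳ (ia ∷ al) lin
    with refl ← proj₁ (RepA-unique {u = u} {u′ = suc u′} (s∈ , refl) ra′)
    with refl ← index-shift∷ʳ π e =
    ∈-++⁺ʳ (tightA₁ v (boundedA (suc v)) n) (cons-shift∷ʳ-complete complete₀ s∈ s₀∈ al′ part)

  boundedA-complete : ∀ j {n π} → BelowA j n π → π ∈ boundedA j n
  tightA-complete : ∀ j {n π} → APart m S n π → ExactA j π → π ∈ tightA j n

  boundedA-complete zero {π = []} ((_ , _ , refl) , _) = here refl
  boundedA-complete zero {π = a ∷ π} (((u , s , ra) ∷ _ , _) , b) with () ← b u ra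
  boundedA-complete (suc j) {n} (part , b) =
    [ (λ b′ → ∈-++⁺ˡ (boundedA-complete j (part , b′)))
    , (λ exact → ∈-++⁺ʳ (boundedA j n) (tightA-complete j part exact)) ]′
    (BoundedA-split (proj₁ part) b)

  tightA-complete (suc (suc (suc v))) = tightA-complete-at v (boundedA-complete (suc v)) (boundedA-complete v)
  tightA-complete zero {π = _ ∷ _} _ (_ , _ , _ , ())
  tightA-complete (suc zero) {π = _ ∷ _} _ (_ , _ , _ , ())
  tightA-complete (suc (suc zero)) {π = _ ∷ _} _ (_ , _ , _ , ())

  shift-injective : ∀ {π π′} → shift π ≡ shift π′ → π ≡ π′
  shift-injective = map-injective (+-cancelˡ-≡ m _ _)

  tightA₁-unique : ∀ v {G n} → (∀ k → Unique (G k)) → Unique (tightA₁ v G n)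
  tightA₁-unique v {G} {n} uG = extensions-unique (v * m +_) (extendA v) G n S-unique uG injective
    where
      injective : ∀ {s s′ π π′} → s ∈ S → s′ ∈ S → extendA v s π ≡ extendA v s′ π′ → s ≡ s′ × π ≡ π′
      injective {π = π} {π′} s∈ s′∈ eq with heads , tails ← ∷-injective eq =
        same-residue (v ∸ length π) (v ∸ length π′) s∈ s′∈ heads , shift-injective tails

  tightA₂-unique : ∀ v {G n} → (∀ k → Unique (G k)) → Unique (tightA₂ v G n)
  tightA₂-unique (suc (suc w)) {G} {n} uG =
    extensions-unique (λ p → suc w * m + uncurry _+_ p) (extendB (suc w)) G n
      (Unique.cartesianProduct⁺ S-unique S-unique) uG injective
    where
      injective : ∀ {p p′ π π′} → p ∈ pairs → p′ ∈ pairs →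
        extendB (suc w) p π ≡ extendB (suc w) p′ π′ → p ≡ p′ × π ≡ π′
      injective {_ , s₁} {_ , s₁′} {π} {π′} p∈ p′∈ eq
        with heads , tails ← ∷-injective eq
        with shifts , refl ← ∷ʳ-injective (shift π) (shift π′) tails
        with refl ← same-residue (suc w ∸ length π) (suc w ∸ length π′)
                      (proj₂ (∈-cartesianProduct⁻ S S p∈)) (proj₂ (∈-cartesianProduct⁻ S S p′∈)) heads =
        refl , shift-injective shifts
  tightA₂-unique zero _ = []
  tightA₂-unique (suc zero) _ = []

  tightA₁₂-disjoint : ∀ v {G G′ n} → (∀ {k π} → π ∈ G k → All (InA m S) π) →
    Disjoint (tightA₁ v G n) (tightA₂ v G′ n)
  tightA₁₂-disjoint (suc (suc w)) {G} {G′} {n} allA (π∈₁ , π∈₂)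
    with s , π₁ , _ , _ , π₁∈ , refl ← ∈-extensions⁻ (suc (suc w) * m +_) (extendA (suc (suc w))) G n S π∈₁
    with (s₀ , s₁) , π₂ , p∈ , _ , _ , eq
           ← ∈-extensions⁻ (λ p → suc w * m + uncurry _+_ p) (extendB (suc w)) G′ n pairs π∈₂ =
    S-¬High (proj₁ (∈-cartesianProduct⁻ S S p∈))
      (proj₂ (Allₚ.∷ʳ⁻ (subst (All High) (∷-injectiveʳ eq) (shift-High (allA π₁∈)))))

  boundedA-unique : ∀ j n → Unique (boundedA j n)
  tightA-unique : ∀ j n → Unique (tightA j n)

  boundedA-unique zero n = guard-unique (n ≟ 0) ([] ∷ [])
  boundedA-unique (suc j) n = Unique.++⁺ (boundedA-unique j n) (tightA-unique j n)
    λ (π∈b , π∈t) → proj₂ (tightA-sound j π∈t) (proj₂ (boundedA-sound j π∈b))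

  tightA-unique (suc (suc (suc v))) n =
    Unique.++⁺ (tightA₁-unique v (boundedA-unique (suc v))) (tightA₂-unique v (boundedA-unique v))
      (tightA₁₂-disjoint v {boundedA (suc v)} {boundedA v}
                         (λ π∈ → proj₁ (proj₁ (boundedA-sound (suc v) π∈))))
  tightA-unique zero n = []
  tightA-unique (suc zero) n = []
  tightA-unique (suc (suc zero)) n = []

  -- The generator of weighted H-partitions

  sums : List ℕ
  sums = deduplicate _≟_ (map (uncurry _+_) pairs)

  ∈-sums⁺ : ∀ {s₀ s₁} → s₀ ∈ S → s₁ ∈ S → s₀ + s₁ ∈ sums
  ∈-sums⁺ s₀∈ s₁∈ = ∈-deduplicate⁺ _≟_ (∈-map⁺ (uncurry _+_) (∈-cartesianProduct⁺ s₀∈ s₁∈))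

  ∈-sums⁻ : ∀ {t} → t ∈ sums → In2S S t
  ∈-sums⁻ t∈
    with (s₀ , s₁) , p∈ , refl ← ∈-map⁻ (uncurry _+_) (∈-deduplicate⁻ _≟_ (map (uncurry _+_) pairs) t∈) =
    let s₀∈ , s₁∈ = ∈-cartesianProduct⁻ S S p∈ in s₀ , s₁ , s₀∈ , s₁∈ , refl

  sums-unique : Unique sums
  sums-unique = deduplicate-! _≟_ (map (uncurry _+_) pairs)

  Weighted : Set
  Weighted = List ℕ × ℕ

  tightH₁ : ℕ → (ℕ → List Weighted) → ℕ → List Weighted
  tightH₁ v G n = extensions (v * m +_) (λ s → Product.map (v * m + s ∷_) (1 *_)) G n S

  tightH₂ : ℕ → (ℕ → List Weighted) → ℕ → List Weighted
  tightH₂ (suc (suc w)) G n =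
    extensions (suc w * m +_) (λ t → Product.map (suc w * m + t ∷_) (countPairs S t *_)) G n sums
  tightH₂ _ _ _ = []

  -- boundedH j n lists, with their weights, the H-partitions of n that may follow a part h
  -- with v(h) = j − 1.
  boundedH : ℕ → ℕ → List Weighted
  tightH : ℕ → ℕ → List Weighted

  boundedH zero n = guard (n ≟ 0) (([] , 1) ∷ [])
  boundedH (suc j) n = boundedH j n ++ tightH j n

  tightH (suc (suc (suc v))) n = tightH₁ v (boundedH (suc v)) n ++ tightH₂ v (boundedH v) n
  tightH _ _ = []

  FitsBelowH : ℕ → ℕ → Set
  FitsBelowH j h = ∀ v {t} → RepH m S h v t → 4 + v ≤ j × (InB m S h → 5 + v ≤ j)

  BoundedH : ℕ → List ℕ → Set
  BoundedH j [] = ⊤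
  BoundedH j (h ∷ _) = FitsBelowH j h

  BelowH : ℕ → ℕ → Weighted → Set
  BelowH j n q = HPart m S n (proj₁ q) × BoundedH j (proj₁ q) × ProdWeight m S (proj₁ q) (proj₂ q)

  AtH : ℕ → ℕ → Weighted → Set
  AtH j n q = BelowH (suc j) n q × ¬ BoundedH j (proj₁ q)

  FitsBelowH-intro : ∀ {j h v t} → RepH m S h v t → 4 + v ≤ j → (InB m S h → 5 + v ≤ j) → FitsBelowH j h
  FitsBelowH-intro {v = v} r le leB v′ r′ with refl ← proj₁ (RepH-unique {v = v} {v′ = v′} r r′) = le , leB

  BoundedH-suc : ∀ {j} π → BoundedH j π → BoundedH (suc j) π
  BoundedH-suc [] _ = tt
  BoundedH-suc (h ∷ π) b v r = m≤n⇒m≤1+n (proj₁ (b v r)) , m≤n⇒m≤1+n ∘ proj₂ (b v r)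

  FitsBelowH⇒StepH : ∀ {h h′ v t} → RepH m S h v t → FitsBelowH (suc v) h′ → StepH m S h h′
  FitsBelowH⇒StepH {v = v} r b {v₁} {_} {v′} r₁ r′ with refl ← proj₁ (RepH-unique {v = v} {v′ = v₁} r r₁) =
    subst (_≤ v) (+-comm 3 v′) (≤-pred (proj₁ (b v′ r′))) ,
    λ ib → subst (_≤ v) (+-comm 4 v′) (≤-pred (proj₂ (b v′ r′) ib))

  StepH⇒FitsBelowH : ∀ {h h′ v t} → RepH m S h v t → StepH m S h h′ → FitsBelowH (suc v) h′
  StepH⇒FitsBelowH {v = v} r st v′ r′ =
    s≤s (subst (_≤ v) (+-comm v′ 3) (proj₁ (st {v = v} {v' = v′} r r′))) ,
    λ ib → s≤s (subst (_≤ v) (+-comm v′ 4) (proj₂ (st {v = v} {v' = v′} r r′) ib))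

  cons-HPart : ∀ {h v t k π} → RepH m S h v t → InH m S h → HPart m S k π → BoundedH (suc v) π →
    HPart m S (h + k) (h ∷ π)
  cons-HPart r ih (al , [] , refl) _ = ih ∷ al , [-] , refl
  cons-HPart r ih (al , [-] , refl) b = ih ∷ al , FitsBelowH⇒StepH r b ∷ [-] , refl
  cons-HPart r ih (al , l@(_ ∷ _) , refl) b = ih ∷ al , FitsBelowH⇒StepH r b ∷ l , refl

  uncons-HPart : ∀ {h v t n π} → RepH m S h v t → HPart m S n (h ∷ π) →
    h ≤ n × HPart m S (n ∸ h) π × BoundedH (suc v) π
  uncons-HPart {π = []} r (_ ∷ al , _ , sm) = let fits , rest = split-sum sm in fits , (al , [] , rest) , tt
  uncons-HPart {π = _ ∷ _} r (_ ∷ al , st ∷ l , sm) =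
    let fits , rest = split-sum sm in fits , (al , l , rest) , StepH⇒FitsBelowH r st

  Weight-A : ∀ {h} → InA m S h → Weight m S h 1
  Weight-A ia = (λ _ → refl) , (λ ib → ⊥-elim (InA⇒¬InB ia ib))

  Weight-B : ∀ {h v t} → InB m S h → RepH m S h v t → Weight m S h (countPairs S t)
  Weight-B {v = v} ib r = (λ ia → ⊥-elim (InA⇒¬InB ia ib)) ,
                          (λ _ {v′} r′ → cong (countPairs S) (proj₂ (RepH-unique {v = v} {v′ = v′} r r′)))

  In2S⇒InB : ∀ w {t} → In2S S t → InB m S (suc w * m + t)
  In2S⇒InB w (s₀ , s₁ , s₀∈ , s₁∈ , refl) =
    suc w , s₀ , s₁ , s≤s z≤n , s₀∈ , s₁∈ , sym (+-assoc (suc w * m) s₀ s₁)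

  consA-AtH : ∀ {v s n q} → s ∈ S → v * m + s ≤ n → BelowH (suc v) (n ∸ (v * m + s)) q →
    AtH (3 + v) n (Product.map (v * m + s ∷_) (1 *_) q)
  consA-AtH {v} {s} s∈ fits (part , b , pw) =
    (subst (λ k → HPart m S k _) (m+[n∸m]≡n fits) (cons-HPart r (inj₁ ia) part b) ,
     FitsBelowH-intro r ≤-refl (⊥-elim ∘ InA⇒¬InB ia) ,
     Weight-A ia ∷ pw) ,
    λ b′ → 1+n≰n (proj₁ (b′ v r))
    where
      ia : InA m S (v * m + s)
      ia = v , s , s∈ , refl
      r : RepH m S (v * m + s) v s
      r = inj₁ s∈ , refl

  consB-AtH : ∀ {w t n q} → t ∈ sums → suc w * m + t ≤ n → BelowH (2 + w) (n ∸ (suc w * m + t)) q →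
    AtH (5 + w) n (Product.map (suc w * m + t ∷_) (countPairs S t *_) q)
  consB-AtH {w} {t} t∈ fits (part , b , pw) =
    (subst (λ k → HPart m S k _) (m+[n∸m]≡n fits) (cons-HPart r (inj₂ ib) part b) ,
     FitsBelowH-intro r (n≤1+n (4 + suc w)) (λ _ → ≤-refl) ,
     Weight-B {v = suc w} ib r ∷ pw) ,
    λ b′ → 1+n≰n (proj₂ (b′ (suc w) r) ib)
    where
      ib : InB m S (suc w * m + t)
      ib = In2S⇒InB w (∈-sums⁻ t∈)
      r : RepH m S (suc w * m + t) (suc w) t
      r = inj₂ (∈-sums⁻ t∈) , refl

  tightH₁-sound : ∀ v {G} → (∀ {k q} → q ∈ G k → BelowH (suc v) k q) →
    ∀ {n q} → q ∈ tightH₁ v G n → AtH (3 + v) n q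
  tightH₁-sound v {G} sound {n} q∈
    with s , _ , s∈ , fits , q′∈ , refl
           ← ∈-extensions⁻ (v * m +_) (λ s → Product.map (v * m + s ∷_) (1 *_)) G n S q∈ =
    consA-AtH s∈ fits (sound q′∈)

  tightH₂-sound : ∀ v {G} → (∀ {k q} → q ∈ G k → BelowH v k q) →
    ∀ {n q} → q ∈ tightH₂ v G n → AtH (3 + v) n q
  tightH₂-sound (suc (suc w)) {G} sound {n} q∈
    with t , _ , t∈ , fits , q′∈ , refl
           ← ∈-extensions⁻ (suc w * m +_) (λ t → Product.map (suc w * m + t ∷_) (countPairs S t *_))
                           G n sums q∈ =
    consB-AtH t∈ fits (sound q′∈)

  boundedH-sound : ∀ j {n q} → q ∈ boundedH j n → BelowH j n q
  tightH-sound : ∀ j {n q} → q ∈ tightH j n → AtH j n q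

  boundedH-sound zero {zero} (here refl) = ([] , [] , refl) , tt , []
  boundedH-sound (suc j) {n} q∈ =
    [ (λ q∈b → let part , b , pw = boundedH-sound j q∈b in part , BoundedH-suc _ b , pw)
    , (λ q∈t → proj₁ (tightH-sound j q∈t)) ]′
    (∈-++⁻ (boundedH j n) q∈)

  tightH-sound (suc (suc (suc v))) {n} q∈ =
    [ tightH₁-sound v (boundedH-sound (suc v)) , tightH₂-sound v (boundedH-sound v) ]′
    (∈-++⁻ (tightH₁ v (boundedH (suc v)) n) q∈)

  InH⇒RepH : ∀ {h} → InH m S h → ∃[ v ] ∃[ t ] RepH m S h v t
  InH⇒RepH (inj₁ (v , s , ra)) = v , s , RepA⇒RepH {u = v} ra
  InH⇒RepH (inj₂ (u , s₀ , s₁ , _ , s₀∈ , s₁∈ , eq)) =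
    u , s₀ + s₁ , inj₂ (s₀ , s₁ , s₀∈ , s₁∈ , refl) , trans eq (+-assoc (u * m) s₀ s₁)

  ExactH : ℕ → List ℕ → Set
  ExactH j [] = ⊥
  ExactH j (h ∷ _) = (∃[ v ] ∃[ s ] (RepA m S h v s × 3 + v ≡ j))
                   ⊎ (∃[ w ] ∃[ t ] (In2S S t × h ≡ suc w * m + t × 5 + w ≡ j))

  BoundedH-split : ∀ {j π} → All (InH m S) π → BoundedH (suc j) π → BoundedH j π ⊎ ExactH j π
  BoundedH-split [] _ = inj₁ tt
  BoundedH-split {j} (inj₁ ia@(v , s , ra) ∷ _) b with 4 + v ≤? j
  ... | yes le = inj₁ (FitsBelowH-intro (RepA⇒RepH {u = v} ra) le (⊥-elim ∘ InA⇒¬InB ia))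
  ... | no ¬le = inj₂ (inj₁ (v , s , ra , ≤-antisym (≤-pred (proj₁ (b v (RepA⇒RepH {u = v} ra))))
                                                  (≤-pred (≰⇒> ¬le))))
  BoundedH-split {j} (inj₂ ib@(suc w , s₀ , s₁ , _ , s₀∈ , s₁∈ , _) ∷ _) b
    with r ← proj₂ (proj₂ (InH⇒RepH (inj₂ ib)))
    with 6 + w ≤? j
  ... | yes le = inj₁ (FitsBelowH-intro r (≤-trans (n≤1+n _) le) (λ _ → le))
  ... | no ¬le = inj₂ (inj₂ (w , s₀ + s₁ , (s₀ , s₁ , s₀∈ , s₁∈ , refl) , proj₂ r ,
                             ≤-antisym (≤-pred (proj₂ (b (suc w) r) ib)) (≤-pred (≰⇒> ¬le))))

  tightH-complete-at : ∀ v →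
    (∀ {k π} → HPart m S k π → BoundedH (suc v) π → ∃[ w ] (π , w) ∈ boundedH (suc v) k) →
    (∀ {k π} → HPart m S k π → BoundedH v π → ∃[ w ] (π , w) ∈ boundedH v k) →
    ∀ {n π} → HPart m S n π → ExactH (3 + v) π → ∃[ w ] (π , w) ∈ tightH (3 + v) n
  tightH-complete-at v complete₁ _ {n} {h ∷ π} part (inj₁ (v , s , ra@(s∈ , refl) , refl))
    with fits , tail , b ← uncons-HPart (RepA⇒RepH {u = v} ra) part
    with w , q∈ ← complete₁ tail b =
    1 * w , ∈-++⁺ˡ (∈-extensions⁺ (v * m +_) (λ s → Product.map (v * m + s ∷_) (1 *_))
                                  (boundedH (suc v)) n S s∈ fits q∈)
  tightH-complete-at _ _ complete₀ {n} {h ∷ π} part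
                     (inj₂ (w , t , t2@(s₀ , s₁ , s₀∈ , s₁∈ , refl) , refl , refl))
    with fits , tail , b ← uncons-HPart {v = suc w} (inj₂ t2 , refl) part
    with w′ , q∈ ← complete₀ tail b =
    countPairs S t * w′ ,
    ∈-++⁺ʳ (tightH₁ (2 + w) (boundedH (3 + w)) n)
      (∈-extensions⁺ (suc w * m +_) (λ t → Product.map (suc w * m + t ∷_) (countPairs S t *_))
                     (boundedH (2 + w)) n sums (∈-sums⁺ s₀∈ s₁∈) fits q∈)

  boundedH-complete : ∀ j {n π} → HPart m S n π → BoundedH j π → ∃[ w ] (π , w) ∈ boundedH j n
  tightH-complete : ∀ j {n π} → HPart m S n π → ExactH j π → ∃[ w ] (π , w) ∈ tightH j n

  boundedH-complete zero {π = []} (_ , _ , refl) _ = 1 , here refl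
  boundedH-complete zero {π = h ∷ π} (ih ∷ _ , _) b with v , t , r ← InH⇒RepH ih with () ← proj₁ (b v r)
  boundedH-complete (suc j) {n} part b =
    [ (λ b′ → Product.map₂ ∈-++⁺ˡ (boundedH-complete j part b′))
    , (λ exact → Product.map₂ (∈-++⁺ʳ (boundedH j n)) (tightH-complete j part exact)) ]′
    (BoundedH-split (proj₁ part) b)

  tightH-complete (suc (suc (suc v))) = tightH-complete-at v (boundedH-complete (suc v)) (boundedH-complete v)
  tightH-complete zero {π = _ ∷ _} _ (inj₁ (_ , _ , _ , ()))
  tightH-complete zero {π = _ ∷ _} _ (inj₂ (_ , _ , _ , _ , ()))
  tightH-complete (suc zero) {π = _ ∷ _} _ (inj₁ (_ , _ , _ , ()))
  tightH-complete (suc zero) {π = _ ∷ _} _ (inj₂ (_ , _ , _ , _ , ()))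
  tightH-complete (suc (suc zero)) {π = _ ∷ _} _ (inj₁ (_ , _ , _ , ()))
  tightH-complete (suc (suc zero)) {π = _ ∷ _} _ (inj₂ (_ , _ , _ , _ , ()))

  map-tightH₁ : ∀ v G n →
    map proj₁ (tightH₁ v G n) ≡ extensions (v * m +_) (λ s → v * m + s ∷_) (map proj₁ ∘ G) n S
  map-tightH₁ v G n =
    map-extensions (v * m +_) n proj₁ (λ s → Product.map (v * m + s ∷_) (1 *_)) (λ s → v * m + s ∷_) proj₁ G
                   (λ _ _ → refl) S

  map-tightH₂ : ∀ w G n →
    map proj₁ (tightH₂ (2 + w) G n) ≡ extensions (suc w * m +_) (λ t → suc w * m + t ∷_) (map proj₁ ∘ G) n sums
  map-tightH₂ w G n =
    map-extensions (suc w * m +_) n proj₁ (λ t → Product.map (suc w * m + t ∷_) (countPairs S t *_))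
                   (λ t → suc w * m + t ∷_) proj₁ G
                   (λ _ _ → refl) sums

  tightH₁-unique : ∀ v {G n} → (∀ k → Unique (map proj₁ (G k))) → Unique (map proj₁ (tightH₁ v G n))
  tightH₁-unique v {G} {n} uG =
    subst Unique (sym (map-tightH₁ v G n))
      (extensions-unique (v * m +_) (λ s → v * m + s ∷_) (map proj₁ ∘ G) n S-unique uG
        (λ s∈ s′∈ eq → same-residue v v s∈ s′∈ (∷-injectiveˡ eq) , ∷-injectiveʳ eq))

  tightH₂-unique : ∀ v {G n} → (∀ k → Unique (map proj₁ (G k))) → Unique (map proj₁ (tightH₂ v G n))
  tightH₂-unique (suc (suc w)) {G} {n} uG =
    subst Unique (sym (map-tightH₂ w G n))
      (extensions-unique (suc w * m +_) (λ t → suc w * m + t ∷_) (map proj₁ ∘ G) n sums-unique uG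
        (λ _ _ eq → +-cancelˡ-≡ (suc w * m) _ _ (∷-injectiveˡ eq) , ∷-injectiveʳ eq))
  tightH₂-unique zero _ = []
  tightH₂-unique (suc zero) _ = []

  tightH₁₂-disjoint : ∀ v {G G′ n} → Disjoint (map proj₁ (tightH₁ v G n)) (map proj₁ (tightH₂ v G′ n))
  tightH₁₂-disjoint (suc (suc w)) {G} {G′} {n} {π} (π∈₁ , π∈₂)
    with s , _ , s∈ , _ , _ , refl
           ← ∈-extensions⁻ (suc (suc w) * m +_) (λ s → suc (suc w) * m + s ∷_) (map proj₁ ∘ G) n S
                           (subst (π ∈_) (map-tightH₁ (suc (suc w)) G n) π∈₁)
    with t , _ , t∈ , _ , _ , eq
           ← ∈-extensions⁻ (suc w * m +_) (λ t → suc w * m + t ∷_) (map proj₁ ∘ G′) n sums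
                           (subst (π ∈_) (map-tightH₂ w G′ n) π∈₂) =
    InA⇒¬InB (suc (suc w) , s , s∈ , refl) (subst (InB m S) (sym (∷-injectiveˡ eq)) (In2S⇒InB w (∈-sums⁻ t∈)))

  boundedH-unique : ∀ j n → Unique (map proj₁ (boundedH j n))
  tightH-unique : ∀ j n → Unique (map proj₁ (tightH j n))

  boundedH-unique zero zero = [] ∷ []
  boundedH-unique zero (suc n) = []
  boundedH-unique (suc j) n =
    subst Unique (sym (map-++ proj₁ (boundedH j n) _))
      (Unique.++⁺ (boundedH-unique j n) (tightH-unique j n) disjoint)
    where
      disjoint : Disjoint (map proj₁ (boundedH j n)) (map proj₁ (tightH j n))
      disjoint (π∈b , π∈t) with q , q∈ , refl ← ∈-map⁻ proj₁ π∈b with q′ , q′∈ , eq ← ∈-map⁻ proj₁ π∈t =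
        proj₂ (tightH-sound j q′∈) (subst (BoundedH j) eq (proj₁ (proj₂ (boundedH-sound j q∈))))

  tightH-unique (suc (suc (suc v))) n =
    subst Unique (sym (map-++ proj₁ (tightH₁ v (boundedH (suc v)) n) _))
      (Unique.++⁺ (tightH₁-unique v (boundedH-unique (suc v))) (tightH₂-unique v (boundedH-unique v))
                  (tightH₁₂-disjoint v {boundedH (suc v)} {boundedH v}))
  tightH-unique zero n = []
  tightH-unique (suc zero) n = []
  tightH-unique (suc (suc zero)) n = []

  -- Weighted counts

  tightA₁-count : ∀ v {G G′} → (∀ k → length (G k) ≡ sum (map proj₂ (G′ k))) →
    ∀ n → length (tightA₁ v G n) ≡ sum (map proj₂ (tightH₁ v G′ n))
  tightA₁-count v {G} {G′} count n = begin
    length (tightA₁ v G n)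
      ≡⟨ length≡sum-map-1 (tightA₁ v G n) ⟩
    sum (map (λ _ → 1) (tightA₁ v G n))
      ≡⟨ sum-map-extensions (v * m +_) (extendA v) G n (λ _ → 1) (λ _ → 1) (λ _ → 1) (λ _ _ → refl) S ⟩
    sum (map (λ s → 1 * (if does (v * m + s ≤? n) then sum (map (λ _ → 1) (G (n ∸ (v * m + s)))) else 0)) S)
      ≡⟨ cong sum (map-cong (λ s → cong (λ c → 1 * (if does (v * m + s ≤? n) then c else 0))
                                        (trans (sym (length≡sum-map-1 (G (n ∸ (v * m + s))))) (count _))) S) ⟩
    sum (map (λ s → 1 * (if does (v * m + s ≤? n) then sum (map proj₂ (G′ (n ∸ (v * m + s)))) else 0)) S)
      ≡⟨ sum-map-extensions (v * m +_) (λ s → Product.map (v * m + s ∷_) (1 *_)) G′ n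
                            proj₂ proj₂ (λ _ → 1) (λ _ _ → refl) S ⟨
    sum (map proj₂ (tightH₁ v G′ n)) ∎
    where open ≡-Reasoning

  tightA₂-count : ∀ v {G G′} → (∀ k → length (G k) ≡ sum (map proj₂ (G′ k))) →
    ∀ n → length (tightA₂ v G n) ≡ sum (map proj₂ (tightH₂ v G′ n))
  tightA₂-count (suc (suc w)) {G} {G′} count n = begin
    length (tightA₂ (2 + w) G n)
      ≡⟨ length≡sum-map-1 (tightA₂ (2 + w) G n) ⟩
    sum (map (λ _ → 1) (tightA₂ (2 + w) G n))
      ≡⟨ sum-map-extensions size (extendB (suc w)) G n (λ _ → 1) (λ _ → 1) (λ _ → 1) (λ _ _ → refl) pairs ⟩
    sum (map (λ p → 1 * countA (uncurry _+_ p)) pairs)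
      ≡⟨ cong sum (map-cong (λ p → trans (*-identityˡ _) (cong (λ c → if does (size p ≤? n) then c else 0)
                                     (trans (sym (length≡sum-map-1 (G (n ∸ size p)))) (count _)))) pairs) ⟩
    sum (map (countH ∘ uncurry _+_) pairs)
      ≡⟨ sum-map-fibres (uncurry _+_) countH pairs sums-unique (λ p∈ → ∈-deduplicate⁺ _≟_ (∈-map⁺ _ p∈)) ⟨
    sum (map (λ t → countPairs S t * countH t) sums)
      ≡⟨ sum-map-extensions (suc w * m +_) (λ t → Product.map (suc w * m + t ∷_) (countPairs S t *_)) G′ n
                            proj₂ proj₂ (countPairs S) (λ _ _ → refl) sums ⟨
    sum (map proj₂ (tightH₂ (2 + w) G′ n)) ∎
    where
      open ≡-Reasoning
      size : ℕ × ℕ → ℕ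
      size p = suc w * m + uncurry _+_ p
      countA countH : ℕ → ℕ
      countA t = if does (suc w * m + t ≤? n) then sum (map (λ _ → 1) (G (n ∸ (suc w * m + t)))) else 0
      countH t = if does (suc w * m + t ≤? n) then sum (map proj₂ (G′ (n ∸ (suc w * m + t)))) else 0
  tightA₂-count zero _ _ = refl
  tightA₂-count (suc zero) _ _ = refl

  boundedA-count : ∀ j n → length (boundedA j n) ≡ sum (map proj₂ (boundedH j n))
  tightA-count : ∀ j n → length (tightA j n) ≡ sum (map proj₂ (tightH j n))

  boundedA-count zero zero = refl
  boundedA-count zero (suc n) = refl
  boundedA-count (suc j) n =
    trans (length-++ (boundedA j n))
          (trans (cong₂ _+_ (boundedA-count j n) (tightA-count j n)) (sym (sum-map-++ proj₂ (boundedH j n) _)))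

  tightA-count (suc (suc (suc v))) n =
    trans (length-++ (tightA₁ v (boundedA (suc v)) n))
          (trans (cong₂ _+_ (tightA₁-count v {boundedA (suc v)} {boundedH (suc v)} (boundedA-count (suc v)) n)
                            (tightA₂-count v {boundedA v} {boundedH v} (boundedA-count v) n))
                 (sym (sum-map-++ proj₂ (tightH₁ v (boundedH (suc v)) n) _)))
  tightA-count zero n = refl
  tightA-count (suc zero) n = refl
  tightA-count (suc (suc zero)) n = refl

  -- Enumerations

  quotient-≤ : ∀ u t → u ≤ u * m + t
  quotient-≤ u t = ≤-trans (m≤m*n u m) (m≤m+n (u * m) t)

  InA-positive : ∀ {a} → InA m S a → 1 ≤ a
  InA-positive (u , s , s∈ , refl) = ≤-trans (S-positive s∈) (m≤n+m s (u * m))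

  BoundedA-all : ∀ {n π} → APart m S n π → BoundedA (5 + (n + n)) π
  BoundedA-all {π = []} _ = tt
  BoundedA-all {n} {a ∷ π} (_ ∷ al , _ , sm) u {s} (_ , refl) =
    m≤n⇒m≤1+n (+-monoʳ-≤ 4 (+-mono-≤ length≤n u≤n))
    where
      u≤n : u ≤ n
      u≤n = ≤-trans (quotient-≤ u s) (≤-trans (m≤m+n _ (sum π)) (≤-reflexive sm))
      length≤n : length π ≤ n
      length≤n = ≤-trans (length≤sum (All.map InA-positive al)) (≤-trans (m≤n+m (sum π) a) (≤-reflexive sm))

  BoundedH-all : ∀ {n π} → HPart m S n π → BoundedH (5 + (n + n)) π
  BoundedH-all {π = []} _ = tt
  BoundedH-all {n} {h ∷ π} (_ , _ , sm) v {t} (_ , refl) = ≤-trans (n≤1+n _) bound , λ _ → bound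
    where
      bound : 5 + v ≤ 5 + (n + n)
      bound = +-monoʳ-≤ 5 (≤-trans (≤-trans (quotient-≤ v t) (≤-trans (m≤m+n _ (sum π)) (≤-reflexive sm)))
                                   (m≤m+n n n))

  enumerations : (n : ℕ) →
    ∃[ LA ] ∃[ LH ]
      (Enumerates (APart m S n) LA
      × Enumerates (HPart m S n) (map proj₁ LH)
      × All (λ p → ProdWeight m S (proj₁ p) (proj₂ p)) LH
      × length LA ≡ sum (map proj₂ LH))
  enumerations n =
    boundedA bound n , boundedH bound n ,
    (boundedA-unique bound n , (λ _ part → boundedA-complete bound (part , BoundedA-all part)) ,
                           (λ _ π∈ → proj₁ (boundedA-sound bound π∈))) ,
    (boundedH-unique bound n ,
       (λ _ part → ∈-map⁺ proj₁ (proj₂ (boundedH-complete bound part (BoundedH-all part)))) ,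
                           H-sound) ,
    All.tabulate (λ q∈ → proj₂ (proj₂ (boundedH-sound bound q∈))) ,
    boundedA-count bound n
    where
      bound = 5 + (n + n)
      H-sound : ∀ π → π ∈ map proj₁ (boundedH bound n) → HPart m S n π
      H-sound π π∈ with q , q∈ , refl ← ∈-map⁻ proj₁ π∈ = proj₁ (boundedH-sound bound q∈)

-- Positivity of S already follows from sum-freeness (S-positive).
theorem3 : (m : ℕ) → 2 ≤ m → (S : List ℕ) → S ≢ [] → Unique S → All (1 ≤_) S →
    SumFreeMod m S → TwoSumCondition m S →
    (n : ℕ) → 1 ≤ n →
    ∃[ LA ] ∃[ LH ]
      (Enumerates (APart m S n) LA
      × Enumerates (HPart m S n) (map proj₁ LH)
      × All (λ p → ProdWeight m S (proj₁ p) (proj₂ p)) LH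
      × length LA ≡ sum (map proj₂ LH))
theorem3 m 2≤m S _ S-unique _ sumFree twoSum n _ =
  Partitions.enumerations m {{>-nonZero (≤-trans (s≤s z≤n) 2≤m)}} S S-unique sumFree twoSum n
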